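{- For positive integers $n$, $m$ and $s$, we have \begin{align*} \mathfrak Z_n(q;m,s)&=\frac{1}{(1-q)^{m s}\bigl([n-1]_q!\bigr)^s}\left[{n \atop m+1}\right]_q^{(1,s)}\,,\\ \mathfrak Z_n^\star(q;m,s)&=\frac{1}{(1-q)^{m s}}\left\{{n+m-1 \atop n-1}\right\}_q^{(1,-s)}\,. \end{align*}
   Context: Let $[n]_q=\frac{q^n-1}{q-1}$ ($q\ne1$) denote the $q$-number and $[n]_q!=[n]_q[n-1]_q\cdots[1]_q$ with $[0]_q!=1$. Define $$\mathfrak Z_n(q;m,s):=\sum_{1\le i_1<i_2<\dots<i_m\le n-1}\frac{1}{(1-q^{i_1})^{s}\cdots(1-q^{i_m})^{s}},\qquad \mathfrak Z_n^\star(q;m,s):=\sum_{1\le i_1\le i_2\le \dots\le i_m\le n-1}\frac{1}{(1-q^{i_1})^{s}\cdots(1-q^{i_m})^{s}}.$$ For a positive integer $r$ and level $s$, let $(x)_{n,q}^{(r,s)}:=x^r\prod_{i=r}^{n-1}\bigl(x-([i]_q)^s\bigr)$ for $n>r$, with $(x)_{r,q}^{(r,s)}=x^r$. The $q$-generalized $(r,s)$-Stirling numbers of the first kind $\left[{n \atop k}\right]_q^{(r,s)}$ are defined by $(x)_{n,q}^{(r,s)}=\sum_{k=0}^n(-1)^{n-k}\left[{n \atop k}\right]_q^{(r,s)}x^k$; equivalently they satisfy $\left[{n \atop k}\right]_q^{(r,s)}=\left[{n-1 \atop k-1}\right]_q^{(r,s)}+\bigl([n-1]_q\bigr)^s\left[{n-1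 \atop k}\right]_q^{(r,s)}$ with appropriate initial values. The $q$-generalized $(r,s)$-Stirling numbers of the second kind $\left\{{n \atop k}\right\}_q^{(r,s)}$ are defined by $x^n=\sum_{k=0}^n\left\{{n \atop k}\right\}_q^{(r,s)}(x)_{k,q}^{(r,s)}$; equivalently they satisfy $\left\{{n \atop k}\right\}_q^{(r,s)}=\left\{{n-1 \atop k-1}\right\}_q^{(r,s)}+\bigl([k]_q\bigr)^s\left\{{n-1 \atop k}\right\}_q^{(r,s)}$ with $\left\{{0 \atop 0}\right\}_q^{(r,s)}=1$ and $\left\{{n \atop k}\right\}_q^{(r,s)}=0$ for $0\le k\le r-1$. In particular $\left[{n \atop m}\right]_q^{(r,s)}=\left(\frac{[n-1]_q!}{[r-1]_q!}\right)^s\sum_{r\le i_1<\dots<i_{m-r}\le n-1}\bigl([i_1]_q\cdots[i_{m-r}]_q\bigr)^{ -s}$ and $\left\{{n \atop n-k}\right\}_q^{(r,s)}=\sum_{r\le i_1\le\cdots\le i_k\le n-k}([i_1]_q\cdots[i_k]_q)^s$; in the second formula of the claim the level is $-s$, i.e. the powers $([i]_q)^s$ are replaced by $([i]_q)^{ -s}$. -}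

module Defs where

open import Level using (_⊔_) renaming (suc to lsuc)
open import Algebra.Bundles using (CommutativeRing)
open import Data.Nat as ℕ using (ℕ; zero; suc; _∸_; _<?_)
open import Data.Integer as ℤ using (ℤ; +_; -[1+_])
open import Data.List using (List; []; _∷_; map; concatMap; foldr)
open import Relation.Nullary using (¬_; yes; no)

-- A field: a commutative ring with an inverse operation that is a
-- right inverse on all non-zero elements (the value at 0 is unspecified).
record Field c ℓ : Set (lsuc (c ⊔ ℓ)) where
  field
    commutativeRing : CommutativeRing c ℓ
  open CommutativeRing commutativeRing public
  field
    _⁻¹ : Carrier → Carrier
    ⁻¹-inverseʳ : ∀ x → ¬ (x ≈ 0#) → x * (x ⁻¹) ≈ 1#

range : ℕ → ℕ → List ℕ
range lo hi = go (suc hi ∸ lo) lo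
  where
  go : ℕ → ℕ → List ℕ
  go zero    i = []
  go (suc k) i = i ∷ go k (suc i)

incSeqs : ℕ → ℕ → ℕ → List (List ℕ)
incSeqs lo hi zero    = [] ∷ []
incSeqs lo hi (suc m) = concatMap (λ i → map (i ∷_) (incSeqs (suc i) hi m)) (range lo hi)

wkSeqs : ℕ → ℕ → ℕ → List (List ℕ)
wkSeqs lo hi zero    = [] ∷ []
wkSeqs lo hi (suc m) = concatMap (λ i → map (i ∷_) (wkSeqs i hi m)) (range lo hi)

module FieldDefs {c ℓ} (F : Field c ℓ) where
  open Field F

  infixr 8 _^_
  _^_ : Carrier → ℕ → Carrier
  x ^ zero  = 1#
  x ^ suc n = x * (x ^ n)

  _/_ : Carrier → Carrier → Carrier
  x / y = x * (y ⁻¹)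

  _^ℤ_ : Carrier → ℤ → Carrier
  x ^ℤ (+ n)     = x ^ n
  x ^ℤ -[1+ n ]  = (x ⁻¹) ^ suc n

  sumF : List Carrier → Carrier
  sumF = foldr _+_ 0#

  prodF : List Carrier → Carrier
  prodF = foldr _*_ 1#

  qnum : Carrier → ℕ → Carrier
  qnum q n = ((q ^ n) - 1#) / (q - 1#)

  qfact : Carrier → ℕ → Carrier
  qfact q zero    = 1#
  qfact q (suc n) = qnum q (suc n) * qfact q n

  Zeta : Carrier → ℕ → ℕ → ℕ → Carrier
  Zeta q n m s =
    sumF (map (λ is → prodF (map (λ i → ((1# - (q ^ i)) ^ s) ⁻¹) is))
              (incSeqs 1 (n ∸ 1) m))

  ZetaStar : Carrier → ℕ → ℕ → ℕ → Carrier
  ZetaStar q n m s =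
    sumF (map (λ is → prodF (map (λ i → ((1# - (q ^ i)) ^ s) ⁻¹) is))
              (wkSeqs 1 (n ∸ 1) m))

  -- polynomials as ascending coefficient lists
  Poly : Set c
  Poly = List Carrier

  mulX : Poly → Poly
  mulX p = 0# ∷ p

  scale : Carrier → Poly → Poly
  scale a = map (a *_)

  addP : Poly → Poly → Poly
  addP []       q        = q
  addP p        []       = p
  addP (a ∷ p)  (b ∷ q)  = (a + b) ∷ addP p q

  mulLin : Carrier → Poly → Poly
  mulLin a p = addP (mulX p) (scale (- a) p)

  coeff : ℕ → Poly → Carrier
  coeff k       []       = 0#
  coeff zero    (a ∷ p)  = a
  coeff (suc k) (a ∷ p)  = coeff k p

  xPow : ℕ → Poly
  xPow zero    = 1# ∷ []
  xPow (suc r) = mulX (xPow r)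

  -- (x)^{(r,s)}_{n,q} = x^r ∏_{i=r}^{n-1} (x - ([i]_q)^s)   (level s ∈ ℤ)
  qFalling : Carrier → ℕ → ℤ → ℕ → Poly
  qFalling q r s n = foldr (λ i p → mulLin (qnum q i ^ℤ s) p) (xPow r) (range r (n ∸ 1))

  -- q-generalized (r,s)-Stirling numbers of the first kind, defined by
  -- (x)^{(r,s)}_{n,q} = Σ_k (-1)^{n-k} [n k] x^k
  stirling1 : Carrier → ℕ → ℤ → ℕ → ℕ → Carrier
  stirling1 q r s n k = ((- 1#) ^ (n ∸ k)) * coeff k (qFalling q r s n)

  -- q-generalized (r,s)-Stirling numbers of the second kind, via the recurrence
  -- {n k} = {n-1 k-1} + ([k]_q)^s {n-1 k},  {0 0} = 1,  {n k} = 0 for n ≥ 1, 0 ≤ k ≤ r-1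
  stirling2 : Carrier → ℕ → ℤ → ℕ → ℕ → Carrier
  stirling2 q r s zero    zero    = 1#
  stirling2 q r s zero    (suc k) = 0#
  stirling2 q r s (suc n) zero    = 0#
  stirling2 q r s (suc n) (suc k) with suc k <? r
  ... | yes _ = 0#
  ... | no  _ = stirling2 q r s n k + ((qnum q (suc k) ^ℤ s) * stirling2 q r s n (suc k))

module Submission where

-- Since 1 - qⁱ = (1 - q)[i]_q, the weights ((1 - qⁱ)^s)⁻¹ of both sums are (1 - q)^(-s) times
-- ([i]_q^s)⁻¹, so 𝔷_n and 𝔷*_n are (1 - q)^(-ms) times the elementary and the complete homogeneous
-- symmetric functions e_m and h_m of the numbers ([i]_q^s)⁻¹, 1 ≤ i ≤ n - 1.  By Vieta, the
-- coefficient of x^(m+1) in x ∏ (x - aᵢ) is ± (∏ aᵢ) e_m(aᵢ⁻¹); with aᵢ = [i]_q^s this is the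
-- first identity.  The recurrence of the Stirling numbers of the second kind is the recurrence
-- h_m(a₁, …, a_{K+1}) = h_m(a₁, …, a_K) + a_{K+1} h_{m-1}(a₁, …, a_{K+1}), which gives the second.

open import Defs
open import Data.Nat using (ℕ; _≤_; _<_) renaming (_*_ to _*ℕ_; _+_ to _+ℕ_; _∸_ to _∸ℕ_)
open import Data.Integer using (+_) renaming (-_ to -ℤ_)
open import Data.Product using (_×_)
open import Relation.Nullary using (¬_)

open import Data.Integer using (ℤ; -[1+_])
open import Data.Nat using (zero; suc; z≤n; s≤s; _≤?_; _<?_)
open import Data.Nat.Properties as ℕ
  using (≤-refl; ≤-antisym; <⇒≤; ≤-pred; ≰⇒>; ≮⇒≥; m≤n⇒m≤1+n; m≤n⇒m∸n≡0; +-∸-assoc)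
open import Data.List using (List; []; _∷_; _++_; _∷ʳ_; length; map; foldr)
open import Data.List.Properties using (map-∘; map-++; length-map; foldr-map)
open import Data.List.Relation.Unary.All as All using (All; []; _∷_)
open import Data.List.Relation.Unary.All.Properties using (map⁺)
open import Data.List.Relation.Binary.Pointwise using ([]; _∷_)
open import Data.Product using (_,_)
open import Data.Maybe using (nothing)
open import Function using (_∘_)
open import Relation.Binary.PropositionalEquality as ≡ using (_≡_)
open import Relation.Nullary using (yes; no; contradiction)
open import Tactic.RingSolver.Core.AlmostCommutativeRing using (fromCommutativeRing)
import Algebra.Properties.Ring
import Algebra.Properties.CommutativeSemigroup
import Algebra.Properties.CommutativeSemiring.Exp
import Data.List.Relation.Binary.Equality.Setoid

range-cons : ∀ lo hi → lo ≤ hi → range lo hi ≡ lo ∷ range (suc lo) hi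
range-cons lo hi lo≤hi with suc hi ∸ℕ lo | +-∸-assoc 1 lo≤hi
... | _ | ≡.refl = ≡.refl

range-empty : ∀ lo hi → hi < lo → range lo hi ≡ []
range-empty lo hi hi<lo with suc hi ∸ℕ lo | m≤n⇒m∸n≡0 hi<lo
... | _ | ≡.refl = ≡.refl

range-ind : ∀ {p} hi (P : ℕ → Set p) →
            (∀ lo → hi < lo → P lo) → (∀ lo → lo ≤ hi → P (suc lo) → P lo) → ∀ lo → P lo
range-ind hi P empty cons lo = go (suc hi ∸ℕ lo) lo ≤-refl
  where
  go : ∀ k lo → suc hi ∸ℕ lo ≤ k → P lo
  go k lo bound with lo ≤? hi
  ... | no lo≰hi = empty lo (≰⇒> lo≰hi)
  go zero    lo bound | yes lo≤hi = contradiction (≡.subst (_≤ 0) (+-∸-assoc 1 lo≤hi) bound) λ ()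
  go (suc k) lo bound | yes lo≤hi =
    cons lo lo≤hi (go k (suc lo) (≤-pred (≡.subst (_≤ suc k) (+-∸-assoc 1 lo≤hi) bound)))

All-range : ∀ {p} {P : ℕ → Set p} lo hi → (∀ i → lo ≤ i → i ≤ hi → P i) → All P (range lo hi)
All-range {P = P} lo hi = range-ind hi Q empty cons lo
  where
  Q : ℕ → Set _
  Q lo = (∀ i → lo ≤ i → i ≤ hi → P i) → All P (range lo hi)
  empty : ∀ lo → hi < lo → Q lo
  empty lo hi<lo _ rewrite range-empty lo hi hi<lo = []
  cons : ∀ lo → lo ≤ hi → Q (suc lo) → Q lo
  cons lo lo≤hi ih p rewrite range-cons lo hi lo≤hi =
    p lo ≤-refl lo≤hi ∷ ih λ i lo<i i≤hi → p i (<⇒≤ lo<i) i≤hi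

length-range : ∀ lo hi → length (range lo hi) ≡ suc hi ∸ℕ lo
length-range lo hi = range-ind hi (λ lo → length (range lo hi) ≡ suc hi ∸ℕ lo) empty cons lo
  where
  empty : ∀ lo → hi < lo → length (range lo hi) ≡ suc hi ∸ℕ lo
  empty lo hi<lo rewrite range-empty lo hi hi<lo = ≡.sym (m≤n⇒m∸n≡0 hi<lo)
  cons : ∀ lo → lo ≤ hi → length (range (suc lo) hi) ≡ hi ∸ℕ lo → length (range lo hi) ≡ suc hi ∸ℕ lo
  cons lo lo≤hi ih rewrite range-cons lo hi lo≤hi = ≡.trans (≡.cong suc ih) (≡.sym (+-∸-assoc 1 lo≤hi))

range-∷ʳ : ∀ lo hi → lo ≤ suc hi → range lo (suc hi) ≡ range lo hi ∷ʳ suc hi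
range-∷ʳ lo hi = range-ind hi P empty cons lo
  where
  P : ℕ → Set
  P lo = lo ≤ suc hi → range lo (suc hi) ≡ range lo hi ∷ʳ suc hi
  empty : ∀ lo → hi < lo → P lo
  empty lo hi<lo lo≤1+hi with ≤-antisym lo≤1+hi hi<lo
  ... | ≡.refl rewrite range-cons (suc hi) (suc hi) ≤-refl
                     | range-empty (suc (suc hi)) (suc hi) ≤-refl
                     | range-empty (suc hi) hi ≤-refl = ≡.refl
  cons : ∀ lo → lo ≤ hi → P (suc lo) → P lo
  cons lo lo≤hi ih _ rewrite range-cons lo (suc hi) (m≤n⇒m≤1+n lo≤hi)
                           | range-cons lo hi lo≤hi = ≡.cong (lo ∷_) (ih (s≤s lo≤hi))

map-range-∷ʳ : ∀ {a} {A : Set a} (f : ℕ → A) lo hi → lo ≤ suc hi →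
               map f (range lo (suc hi)) ≡ map f (range lo hi) ∷ʳ f (suc hi)
map-range-∷ʳ f lo hi lo≤1+hi = ≡.trans (≡.cong (map f) (range-∷ʳ lo hi lo≤1+hi)) (map-++ f (range lo hi) _)

incSeqs-cons : ∀ lo hi m → lo ≤ hi →
               incSeqs lo hi (suc m) ≡ map (lo ∷_) (incSeqs (suc lo) hi m) ++ incSeqs (suc lo) hi (suc m)
incSeqs-cons lo hi m lo≤hi rewrite range-cons lo hi lo≤hi = ≡.refl

incSeqs-empty : ∀ lo hi m → hi < lo → incSeqs lo hi (suc m) ≡ []
incSeqs-empty lo hi m hi<lo rewrite range-empty lo hi hi<lo = ≡.refl

wkSeqs-cons : ∀ lo hi m → lo ≤ hi →
              wkSeqs lo hi (suc m) ≡ map (lo ∷_) (wkSeqs lo hi m) ++ wkSeqs (suc lo) hi (suc m)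
wkSeqs-cons lo hi m lo≤hi rewrite range-cons lo hi lo≤hi = ≡.refl

wkSeqs-empty : ∀ lo hi m → hi < lo → wkSeqs lo hi (suc m) ≡ []
wkSeqs-empty lo hi m hi<lo rewrite range-empty lo hi hi<lo = ≡.refl

module FieldProperties {c ℓ} (F : Field c ℓ) where
  open Field F
  open FieldDefs F
  open import Relation.Binary.Reasoning.Setoid setoid
  private
    module Exp = Algebra.Properties.CommutativeSemiring.Exp commutativeSemiring
    open Algebra.Properties.CommutativeSemigroup *-commutativeSemigroup
      using (x∙yz≈y∙xz) renaming (interchange to *-interchange)
    open Algebra.Properties.Ring ring using (-‿distribˡ-*; x∙y⁻¹≈ε⇒x≈y)

    ^≡Exp^ : ∀ x n → x ^ n ≡ x Exp.^ n
    ^≡Exp^ x zero    = ≡.refl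
    ^≡Exp^ x (suc n) = ≡.cong (x *_) (^≡Exp^ x n)

  ^-congˡ : ∀ n {x y} → x ≈ y → x ^ n ≈ y ^ n
  ^-congˡ n {x} {y} rewrite ^≡Exp^ x n | ^≡Exp^ y n = Exp.^-congˡ n

  ^-distrib-* : ∀ x y n → (x * y) ^ n ≈ x ^ n * y ^ n
  ^-distrib-* x y n rewrite ^≡Exp^ (x * y) n | ^≡Exp^ x n | ^≡Exp^ y n = Exp.^-distrib-* x y n

  1^n≈1 : ∀ n → 1# ^ n ≈ 1#
  1^n≈1 zero    = refl
  1^n≈1 (suc n) = trans (*-identityˡ _) (1^n≈1 n)

  ^-assocʳ : ∀ x m n → (x ^ m) ^ n ≈ x ^ (m *ℕ n)
  ^-assocʳ x m n rewrite ^≡Exp^ (x ^ m) n | ^≡Exp^ x m | ^≡Exp^ x (m *ℕ n) = Exp.^-assocʳ x m n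

  x≉y⇒x-y≉0 : ∀ {x y} → x ≉ y → x - y ≉ 0#
  x≉y⇒x-y≉0 {x} {y} x≉y x-y≈0 = x≉y (x∙y⁻¹≈ε⇒x≈y x y x-y≈0)

  x≉0⇒1≉0 : ∀ {x} → x ≉ 0# → 1# ≉ 0#
  x≉0⇒1≉0 {x} x≉0 1≈0 = x≉0 (begin
    x      ≈⟨ *-identityʳ x ⟨
    x * 1# ≈⟨ *-congˡ 1≈0 ⟩
    x * 0# ≈⟨ zeroʳ x ⟩
    0#     ∎)

  ⁻¹-inverseˡ : ∀ {x} → x ≉ 0# → x ⁻¹ * x ≈ 1#
  ⁻¹-inverseˡ {x} x≉0 = trans (*-comm (x ⁻¹) x) (⁻¹-inverseʳ x x≉0)

  x⁻¹[xy]≈y : ∀ {x} → x ≉ 0# → ∀ y → x ⁻¹ * (x * y) ≈ y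
  x⁻¹[xy]≈y {x} x≉0 y = begin
    x ⁻¹ * (x * y) ≈⟨ *-assoc (x ⁻¹) x y ⟨
    (x ⁻¹ * x) * y ≈⟨ *-congʳ (⁻¹-inverseˡ x≉0) ⟩
    1# * y         ≈⟨ *-identityˡ y ⟩
    y              ∎

  [xy][x⁻¹z]≈yz : ∀ {x} → x ≉ 0# → ∀ y z → (x * y) * (x ⁻¹ * z) ≈ y * z
  [xy][x⁻¹z]≈yz {x} x≉0 y z = begin
    (x * y) * (x ⁻¹ * z) ≈⟨ *-interchange x y (x ⁻¹) z ⟩
    (x * x ⁻¹) * (y * z) ≈⟨ *-congʳ (⁻¹-inverseʳ x x≉0) ⟩
    1# * (y * z)         ≈⟨ *-identityˡ (y * z) ⟩
    y * z                ∎

  x[yx⁻¹]≈y : ∀ {x} → x ≉ 0# → ∀ y → x * (y * x ⁻¹) ≈ y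
  x[yx⁻¹]≈y {x} x≉0 y = begin
    x * (y * x ⁻¹) ≈⟨ x∙yz≈y∙xz x y (x ⁻¹) ⟩
    y * (x * x ⁻¹) ≈⟨ *-congˡ (⁻¹-inverseʳ x x≉0) ⟩
    y * 1#         ≈⟨ *-identityʳ y ⟩
    y              ∎

  ⁻¹-unique : ∀ {x y} → x ≉ 0# → x * y ≈ 1# → y ≈ x ⁻¹
  ⁻¹-unique {x} {y} x≉0 xy≈1 = begin
    y              ≈⟨ x⁻¹[xy]≈y x≉0 y ⟨
    x ⁻¹ * (x * y) ≈⟨ *-congˡ xy≈1 ⟩
    x ⁻¹ * 1#      ≈⟨ *-identityʳ (x ⁻¹) ⟩
    x ⁻¹           ∎

  *-≉0 : ∀ {x y} → x ≉ 0# → y ≉ 0# → x * y ≉ 0#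
  *-≉0 {x} {y} x≉0 y≉0 xy≈0 = y≉0 (begin
    y              ≈⟨ x⁻¹[xy]≈y x≉0 y ⟨
    x ⁻¹ * (x * y) ≈⟨ *-congˡ xy≈0 ⟩
    x ⁻¹ * 0#      ≈⟨ zeroʳ (x ⁻¹) ⟩
    0#             ∎)

  -x[yz]≈-y[xz] : ∀ x y z → - x * (y * z) ≈ - y * (x * z)
  -x[yz]≈-y[xz] x y z = begin
    - x * (y * z)   ≈⟨ -‿distribˡ-* x (y * z) ⟨
    - (x * (y * z)) ≈⟨ -‿cong (x∙yz≈y∙xz x y z) ⟩
    - (y * (x * z)) ≈⟨ -‿distribˡ-* y (x * z) ⟩
    - y * (x * z)   ∎

  ^-≉0 : ∀ {x} n → x ≉ 0# → x ^ n ≉ 0#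
  ^-≉0 zero    x≉0 = x≉0⇒1≉0 x≉0
  ^-≉0 (suc n) x≉0 = *-≉0 x≉0 (^-≉0 n x≉0)

  prodF-≉0 : 1# ≉ 0# → ∀ {xs} → All (_≉ 0#) xs → prodF xs ≉ 0#
  prodF-≉0 1≉0 []           = 1≉0
  prodF-≉0 1≉0 (x≉0 ∷ xs≉0) = *-≉0 x≉0 (prodF-≉0 1≉0 xs≉0)

  prodF-map-^ : ∀ {A : Set} (f : A → Carrier) n xs → prodF (map (λ x → f x ^ n) xs) ≈ prodF (map f xs) ^ n
  prodF-map-^ f n []       = sym (1^n≈1 n)
  prodF-map-^ f n (x ∷ xs) = trans (*-congˡ (prodF-map-^ f n xs)) (sym (^-distrib-* (f x) _ n))

  prodF-∷ʳ : ∀ xs y → prodF (xs ∷ʳ y) ≈ prodF xs * y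
  prodF-∷ʳ []       y = trans (*-identityʳ y) (sym (*-identityˡ y))
  prodF-∷ʳ (x ∷ xs) y = trans (*-congˡ (prodF-∷ʳ xs y)) (sym (*-assoc x _ y))

  ⁻¹-cong : ∀ {x y} → x ≉ 0# → x ≈ y → x ⁻¹ ≈ y ⁻¹
  ⁻¹-cong x≉0 x≈y = ⁻¹-unique (x≉0 ∘ trans x≈y) (trans (*-congʳ (sym x≈y)) (⁻¹-inverseʳ _ x≉0))

  ⁻¹-distrib-* : ∀ {x y} → x ≉ 0# → y ≉ 0# → (x * y) ⁻¹ ≈ x ⁻¹ * y ⁻¹
  ⁻¹-distrib-* {x} {y} x≉0 y≉0 = sym (⁻¹-unique (*-≉0 x≉0 y≉0) (begin
    (x * y) * (x ⁻¹ * y ⁻¹) ≈⟨ *-interchange x y (x ⁻¹) (y ⁻¹) ⟩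
    (x * x ⁻¹) * (y * y ⁻¹) ≈⟨ *-cong (⁻¹-inverseʳ x x≉0) (⁻¹-inverseʳ y y≉0) ⟩
    1# * 1#                 ≈⟨ *-identityˡ 1# ⟩
    1#                      ∎))

  ⁻¹-^ : ∀ {x} n → x ≉ 0# → (x ^ n) ⁻¹ ≈ (x ⁻¹) ^ n
  ⁻¹-^ zero    x≉0 = sym (⁻¹-unique (x≉0⇒1≉0 x≉0) (*-identityˡ 1#))
  ⁻¹-^ (suc n) x≉0 = trans (⁻¹-distrib-* x≉0 (^-≉0 n x≉0)) (*-congˡ (⁻¹-^ n x≉0))

  ⁻¹-^-* : ∀ {x} m n → x ≉ 0# → ((x ^ n) ⁻¹) ^ m ≈ (x ^ (m *ℕ n)) ⁻¹
  ⁻¹-^-* {x} m n x≉0 = begin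
    ((x ^ n) ⁻¹) ^ m  ≈⟨ ⁻¹-^ m (^-≉0 n x≉0) ⟨
    ((x ^ n) ^ m) ⁻¹  ≈⟨ ⁻¹-cong (^-≉0 m (^-≉0 n x≉0)) (^-assocʳ x n m) ⟩
    (x ^ (n *ℕ m)) ⁻¹ ≡⟨ ≡.cong (λ k → (x ^ k) ⁻¹) (ℕ.*-comm n m) ⟩
    (x ^ (m *ℕ n)) ⁻¹ ∎

  ⁻¹-*-extend : ∀ {x y} → x ≉ 0# → y ≉ 0# → ∀ z → x ⁻¹ * z ≈ (x * y) ⁻¹ * (y * z)
  ⁻¹-*-extend {x} {y} x≉0 y≉0 z = begin
    x ⁻¹ * z                  ≈⟨ *-congˡ (x⁻¹[xy]≈y y≉0 z) ⟨
    x ⁻¹ * (y ⁻¹ * (y * z))   ≈⟨ *-assoc (x ⁻¹) (y ⁻¹) (y * z) ⟨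
    (x ⁻¹ * y ⁻¹) * (y * z)   ≈⟨ *-congʳ (⁻¹-distrib-* x≉0 y≉0) ⟨
    (x * y) ⁻¹ * (y * z)      ∎

module SymmetricFunctions {c ℓ} (F : Field c ℓ) where
  open Field F
  open FieldDefs F
  open FieldProperties F
  open import Relation.Binary.Reasoning.Setoid setoid
  open Data.List.Relation.Binary.Equality.Setoid setoid using (_≋_)
  open Algebra.Properties.Ring ring using (-1*x≈-x; -‿involutive)
  open import Tactic.RingSolver.NonReflective (fromCommutativeRing commutativeRing (λ _ → nothing))
    using (solve; _⊜_; _⊕_; _⊗_)

  elemSym : List Carrier → ℕ → Carrier
  elemSym xs       zero    = 1#
  elemSym []       (suc m) = 0#
  elemSym (x ∷ xs) (suc m) = x * elemSym xs m + elemSym xs (suc m)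

  homSym : List Carrier → ℕ → Carrier
  homSym xs       zero    = 1#
  homSym []       (suc m) = 0#
  homSym (x ∷ xs) (suc m) = x * homSym (x ∷ xs) m + homSym xs (suc m)

  map-≋ : ∀ {A : Set} {f g : A → Carrier} {xs} → All (λ x → f x ≈ g x) xs → map f xs ≋ map g xs
  map-≋ []              = []
  map-≋ (fx≈gx ∷ fs≈gs) = fx≈gx ∷ map-≋ fs≈gs

  elemSym-cong : ∀ {xs ys} → xs ≋ ys → ∀ m → elemSym xs m ≈ elemSym ys m
  elemSym-cong _             zero    = refl
  elemSym-cong []            (suc m) = refl
  elemSym-cong (x≈y ∷ xs≋ys) (suc m) =
    +-cong (*-cong x≈y (elemSym-cong xs≋ys m)) (elemSym-cong xs≋ys (suc m))

  homSym-cong : ∀ {xs ys} → xs ≋ ys → ∀ m → homSym xs m ≈ homSym ys m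
  homSym-cong _             zero    = refl
  homSym-cong []            (suc m) = refl
  homSym-cong (x≈y ∷ xs≋ys) (suc m) =
    +-cong (*-cong x≈y (homSym-cong (x≈y ∷ xs≋ys) m)) (homSym-cong xs≋ys (suc m))

  elemSym-scale : ∀ k xs m → elemSym (map (k *_) xs) m ≈ k ^ m * elemSym xs m
  elemSym-scale k xs       zero    = sym (*-identityˡ 1#)
  elemSym-scale k []       (suc m) = sym (zeroʳ _)
  elemSym-scale k (x ∷ xs) (suc m) = begin
    (k * x) * elemSym (map (k *_) xs) m + elemSym (map (k *_) xs) (suc m)
      ≈⟨ +-cong (*-congˡ (elemSym-scale k xs m)) (elemSym-scale k xs (suc m)) ⟩
    (k * x) * (k ^ m * elemSym xs m) + (k * k ^ m) * elemSym xs (suc m)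
      ≈⟨ solve 5 (λ k x K E E′ → ((k ⊗ x) ⊗ (K ⊗ E) ⊕ (k ⊗ K) ⊗ E′) ⊜ ((k ⊗ K) ⊗ (x ⊗ E ⊕ E′)))
               refl k x (k ^ m) (elemSym xs m) (elemSym xs (suc m)) ⟩
    (k * k ^ m) * (x * elemSym xs m + elemSym xs (suc m)) ∎

  homSym-scale : ∀ k xs m → homSym (map (k *_) xs) m ≈ k ^ m * homSym xs m
  homSym-scale k xs       zero    = sym (*-identityˡ 1#)
  homSym-scale k []       (suc m) = sym (zeroʳ _)
  homSym-scale k (x ∷ xs) (suc m) = begin
    (k * x) * homSym (map (k *_) (x ∷ xs)) m + homSym (map (k *_) xs) (suc m)
      ≈⟨ +-cong (*-congˡ (homSym-scale k (x ∷ xs) m)) (homSym-scale k xs (suc m)) ⟩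
    (k * x) * (k ^ m * homSym (x ∷ xs) m) + (k * k ^ m) * homSym xs (suc m)
      ≈⟨ solve 5 (λ k x K H H′ → ((k ⊗ x) ⊗ (K ⊗ H) ⊕ (k ⊗ K) ⊗ H′) ⊜ ((k ⊗ K) ⊗ (x ⊗ H ⊕ H′)))
               refl k x (k ^ m) (homSym (x ∷ xs) m) (homSym xs (suc m)) ⟩
    (k * k ^ m) * (x * homSym (x ∷ xs) m + homSym xs (suc m)) ∎

  elemSym-vanish : ∀ xs m → length xs < m → elemSym xs m ≈ 0#
  elemSym-vanish []       (suc m) _           = refl
  elemSym-vanish (x ∷ xs) (suc m) (s≤s |xs|<m) = begin
    x * elemSym xs m + elemSym xs (suc m)
      ≈⟨ +-cong (*-congˡ (elemSym-vanish xs m |xs|<m)) (elemSym-vanish xs (suc m) (m≤n⇒m≤1+n |xs|<m)) ⟩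
    x * 0# + 0# ≈⟨ +-identityʳ _ ⟩
    x * 0#      ≈⟨ zeroʳ x ⟩
    0#          ∎

  homSym-∷ʳ : ∀ xs y m → homSym (xs ∷ʳ y) (suc m) ≈ homSym xs (suc m) + y * homSym (xs ∷ʳ y) m
  homSym-∷ʳ []       y m    = +-comm _ 0#
  homSym-∷ʳ (x ∷ xs) y zero = begin
    x * 1# + homSym (xs ∷ʳ y) 1         ≈⟨ +-congˡ (homSym-∷ʳ xs y 0) ⟩
    x * 1# + (homSym xs 1 + y * 1#)     ≈⟨ +-assoc _ _ _ ⟨
    (x * 1# + homSym xs 1) + y * 1#     ∎
  homSym-∷ʳ (x ∷ xs) y (suc m) = begin
    x * homSym (x ∷ ys) (suc m) + homSym ys (suc (suc m))
      ≈⟨ +-cong (*-congˡ (homSym-∷ʳ (x ∷ xs) y m)) (homSym-∷ʳ xs y (suc m)) ⟩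
    x * (homSym (x ∷ xs) (suc m) + y * homSym (x ∷ ys) m) + (homSym xs (suc (suc m)) + y * homSym ys (suc m))
      ≈⟨ solve 6 (λ x y H H′ G G′ → (x ⊗ (H ⊕ y ⊗ G) ⊕ (H′ ⊕ y ⊗ G′))
                                   ⊜ ((x ⊗ H ⊕ H′) ⊕ y ⊗ (x ⊗ G ⊕ G′)))
               refl x y (homSym (x ∷ xs) (suc m)) (homSym xs (suc (suc m))) (homSym (x ∷ ys) m) (homSym ys (suc m)) ⟩
    (x * homSym (x ∷ xs) (suc m) + homSym xs (suc (suc m))) + y * (x * homSym (x ∷ ys) m + homSym ys (suc m)) ∎
    where
    ys : List Carrier
    ys = xs ∷ʳ y

  sign : ℕ → Carrier
  sign j = (- 1#) ^ j

  sign-suc : ∀ j → sign (suc j) ≈ - sign j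
  sign-suc j = -1*x≈-x (sign j)

  sign-square : ∀ j → sign j * sign j ≈ 1#
  sign-square j = begin
    (- 1#) ^ j * (- 1#) ^ j ≈⟨ ^-distrib-* (- 1#) (- 1#) j ⟨
    (- 1# * - 1#) ^ j       ≈⟨ ^-congˡ j (trans (-1*x≈-x (- 1#)) (-‿involutive 1#)) ⟩
    1# ^ j                  ≈⟨ 1^n≈1 j ⟩
    1#                      ∎

  sign-∸ : ∀ {m n} → m < n → sign (n ∸ℕ m) ≈ - sign (n ∸ℕ suc m)
  sign-∸ {m} {n} m<n = trans (reflexive (≡.cong sign (+-∸-assoc 1 m<n))) (sign-suc (n ∸ℕ suc m))

  coeff-addP : ∀ k p r → coeff k (addP p r) ≈ coeff k p + coeff k r
  coeff-addP k       []      r       = sym (+-identityˡ _)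
  coeff-addP k       (a ∷ p) []      = sym (+-identityʳ _)
  coeff-addP zero    (a ∷ p) (b ∷ r) = refl
  coeff-addP (suc k) (a ∷ p) (b ∷ r) = coeff-addP k p r

  coeff-scale : ∀ k a p → coeff k (scale a p) ≈ a * coeff k p
  coeff-scale k       a []      = sym (zeroʳ a)
  coeff-scale zero    a (b ∷ p) = refl
  coeff-scale (suc k) a (b ∷ p) = coeff-scale k a p

  coeff₀-mulLin : ∀ a p → coeff 0 (mulLin a p) ≈ - a * coeff 0 p
  coeff₀-mulLin a p = trans (coeff-addP 0 (mulX p) (scale (- a) p)) (trans (+-identityˡ _) (coeff-scale 0 (- a) p))

  coeff-suc-mulLin : ∀ k a p → coeff (suc k) (mulLin a p) ≈ coeff k p + - a * coeff (suc k) p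
  coeff-suc-mulLin k a p = trans (coeff-addP (suc k) (mulX p) (scale (- a) p)) (+-congˡ (coeff-scale (suc k) (- a) p))

  linearProduct : List Carrier → Poly
  linearProduct = foldr mulLin (xPow 1)

  coeff₀-linearProduct : ∀ xs → coeff 0 (linearProduct xs) ≈ 0#
  coeff₀-linearProduct []       = refl
  coeff₀-linearProduct (x ∷ xs) =
    trans (coeff₀-mulLin x (linearProduct xs)) (trans (*-congˡ (coeff₀-linearProduct xs)) (zeroʳ _))

  coeff-linearProduct : ∀ {xs} → All (_≉ 0#) xs → ∀ m →
    coeff (suc m) (linearProduct xs) ≈ sign (length xs ∸ℕ m) * (prodF xs * elemSym (map _⁻¹ xs) m)
  coeff-linearProduct []            zero    = sym (trans (*-identityˡ _) (*-identityˡ 1#))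
  coeff-linearProduct []            (suc m) = sym (trans (*-identityˡ _) (zeroʳ 1#))
  coeff-linearProduct {x ∷ xs} (x≉0 ∷ xs≉0) zero = begin
    coeff 1 (mulLin x p)               ≈⟨ coeff-suc-mulLin 0 x p ⟩
    coeff 0 p + - x * coeff 1 p        ≈⟨ +-cong (coeff₀-linearProduct xs) (*-congˡ (coeff-linearProduct xs≉0 0)) ⟩
    0# + - x * (sign L * (P * 1#))     ≈⟨ +-identityˡ _ ⟩
    - x * (sign L * (P * 1#))          ≈⟨ -x[yz]≈-y[xz] x (sign L) (P * 1#) ⟩
    - sign L * (x * (P * 1#))          ≈⟨ *-congˡ (*-assoc x P 1#) ⟨
    - sign L * ((x * P) * 1#)          ≈⟨ *-congʳ (sign-suc L) ⟨
    sign (suc L) * ((x * P) * 1#)      ∎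
    where
    p : Poly
    p = linearProduct xs
    L : ℕ
    L = length xs
    P : Carrier
    P = prodF xs
  coeff-linearProduct {x ∷ xs} (x≉0 ∷ xs≉0) (suc m) = begin
    coeff (suc (suc m)) (mulLin x p)
      ≈⟨ coeff-suc-mulLin (suc m) x p ⟩
    coeff (suc m) p + - x * coeff (suc (suc m)) p
      ≈⟨ +-cong (coeff-linearProduct xs≉0 m) (*-congˡ (coeff-linearProduct xs≉0 (suc m))) ⟩
    sign (L ∸ℕ m) * (P * E m) + - x * (sign (L ∸ℕ suc m) * (P * E (suc m)))
      ≈⟨ +-congʳ (*-congˡ ([xy][x⁻¹z]≈yz x≉0 P (E m))) ⟨
    sign (L ∸ℕ m) * ((x * P) * (x ⁻¹ * E m)) + - x * (sign (L ∸ℕ suc m) * (P * E (suc m)))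
      ≈⟨ +-congˡ (trans shift (*-congˡ (sym (*-assoc x P (E (suc m)))))) ⟩
    sign (L ∸ℕ m) * ((x * P) * (x ⁻¹ * E m)) + sign (L ∸ℕ m) * ((x * P) * E (suc m))
      ≈⟨ trans (*-congˡ (distribˡ _ _ _)) (distribˡ _ _ _) ⟨
    sign (L ∸ℕ m) * ((x * P) * (x ⁻¹ * E m + E (suc m))) ∎
    where
    p : Poly
    p = linearProduct xs
    L : ℕ
    L = length xs
    P : Carrier
    P = prodF xs
    E : ℕ → Carrier
    E = elemSym (map _⁻¹ xs)
    annihilate : ∀ a b {y} → y ≈ 0# → a * (b * y) ≈ 0#
    annihilate a b y≈0 = trans (*-congˡ (trans (*-congˡ y≈0) (zeroʳ b))) (zeroʳ a)
    shift : - x * (sign (L ∸ℕ suc m) * (P * E (suc m))) ≈ sign (L ∸ℕ m) * (x * (P * E (suc m)))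
    shift with m <? L
    ... | yes m<L = trans (-x[yz]≈-y[xz] x (sign (L ∸ℕ suc m)) (P * E (suc m)))
                          (*-congʳ (sym (sign-∸ m<L)))
    ... | no  m≮L = trans (annihilate _ _ PE≈0) (sym (annihilate _ _ PE≈0))
      where
      PE≈0 : P * E (suc m) ≈ 0#
      PE≈0 = trans (*-congˡ (elemSym-vanish (map _⁻¹ xs) (suc m)
                      (s≤s (≡.subst (_≤ m) (≡.sym (length-map _⁻¹ xs)) (≮⇒≥ m≮L))))) (zeroʳ P)

  weight : (ℕ → Carrier) → List ℕ → Carrier
  weight g is = prodF (map g is)

  weightSum : (ℕ → Carrier) → List (List ℕ) → Carrier
  weightSum g iss = sumF (map (weight g) iss)

  weightSum-∷-++ : ∀ g i iss jss → weightSum g (map (i ∷_) iss ++ jss) ≈ g i * weightSum g iss + weightSum g jss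
  weightSum-∷-++ g i []         jss = sym (trans (+-congʳ (zeroʳ (g i))) (+-identityˡ _))
  weightSum-∷-++ g i (is ∷ iss) jss = begin
    g i * weight g is + weightSum g (map (i ∷_) iss ++ jss)
      ≈⟨ +-congˡ (weightSum-∷-++ g i iss jss) ⟩
    g i * weight g is + (g i * weightSum g iss + weightSum g jss)
      ≈⟨ solve 4 (λ a b c d → (a ⊗ b ⊕ (a ⊗ c ⊕ d)) ⊜ (a ⊗ (b ⊕ c) ⊕ d))
               refl (g i) (weight g is) (weightSum g iss) (weightSum g jss) ⟩
    g i * (weight g is + weightSum g iss) + weightSum g jss ∎

  weightSum-incSeqs : ∀ g lo hi m → weightSum g (incSeqs lo hi m) ≈ elemSym (map g (range lo hi)) m
  weightSum-incSeqs g lo hi = range-ind hi P empty cons lo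
    where
    P : ℕ → Set _
    P lo = ∀ m → weightSum g (incSeqs lo hi m) ≈ elemSym (map g (range lo hi)) m
    empty : ∀ lo → hi < lo → P lo
    empty lo hi<lo zero = +-identityʳ 1#
    empty lo hi<lo (suc m) rewrite incSeqs-empty lo hi m hi<lo | range-empty lo hi hi<lo = refl
    cons : ∀ lo → lo ≤ hi → P (suc lo) → P lo
    cons lo lo≤hi ih rewrite range-cons lo hi lo≤hi = go
      where
      go : ∀ m → weightSum g (incSeqs lo hi m) ≈ elemSym (g lo ∷ map g (range (suc lo) hi)) m
      go zero    = +-identityʳ 1#
      go (suc m) = begin
        weightSum g (incSeqs lo hi (suc m))
          ≡⟨ ≡.cong (weightSum g) (incSeqs-cons lo hi m lo≤hi) ⟩
        weightSum g (map (lo ∷_) (incSeqs (suc lo) hi m) ++ incSeqs (suc lo) hi (suc m))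
          ≈⟨ weightSum-∷-++ g lo (incSeqs (suc lo) hi m) (incSeqs (suc lo) hi (suc m)) ⟩
        g lo * weightSum g (incSeqs (suc lo) hi m) + weightSum g (incSeqs (suc lo) hi (suc m))
          ≈⟨ +-cong (*-congˡ (ih m)) (ih (suc m)) ⟩
        elemSym (g lo ∷ map g (range (suc lo) hi)) (suc m) ∎

  weightSum-wkSeqs : ∀ g lo hi m → weightSum g (wkSeqs lo hi m) ≈ homSym (map g (range lo hi)) m
  weightSum-wkSeqs g lo hi = range-ind hi P empty cons lo
    where
    P : ℕ → Set _
    P lo = ∀ m → weightSum g (wkSeqs lo hi m) ≈ homSym (map g (range lo hi)) m
    empty : ∀ lo → hi < lo → P lo
    empty lo hi<lo zero = +-identityʳ 1#
    empty lo hi<lo (suc m) rewrite wkSeqs-empty lo hi m hi<lo | range-empty lo hi hi<lo = refl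
    cons : ∀ lo → lo ≤ hi → P (suc lo) → P lo
    cons lo lo≤hi ih rewrite range-cons lo hi lo≤hi = go
      where
      go : ∀ m → weightSum g (wkSeqs lo hi m) ≈ homSym (g lo ∷ map g (range (suc lo) hi)) m
      go zero    = +-identityʳ 1#
      go (suc m) = begin
        weightSum g (wkSeqs lo hi (suc m))
          ≡⟨ ≡.cong (weightSum g) (wkSeqs-cons lo hi m lo≤hi) ⟩
        weightSum g (map (lo ∷_) (wkSeqs lo hi m) ++ wkSeqs (suc lo) hi (suc m))
          ≈⟨ weightSum-∷-++ g lo (wkSeqs lo hi m) (wkSeqs (suc lo) hi (suc m)) ⟩
        g lo * weightSum g (wkSeqs lo hi m) + weightSum g (wkSeqs (suc lo) hi (suc m))
          ≈⟨ +-cong (*-congˡ (go m)) (ih (suc m)) ⟩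
        homSym (g lo ∷ map g (range (suc lo) hi)) (suc m) ∎

module QCalculus {c ℓ} (F : Field c ℓ) (q : Field.Carrier F) where
  open Field F
  open FieldDefs F
  open FieldProperties F
  open SymmetricFunctions F
  open import Relation.Binary.Reasoning.Setoid setoid
  open Algebra.Properties.Ring ring using (-‿distribˡ-*; ⁻¹-anti-homo-//)

  qRoots : ℤ → ℕ → List Carrier
  qRoots z N = map (λ i → qnum q i ^ℤ z) (range 1 N)

  length-qRoots : ∀ z N → length (qRoots z N) ≡ N
  length-qRoots z N = ≡.trans (length-map _ (range 1 N)) (length-range 1 N)

  stirling1-elemSym : ∀ z N m → All (_≉ 0#) (qRoots z N) →
    stirling1 q 1 z (suc N) (suc m) ≈ prodF (qRoots z N) * elemSym (map _⁻¹ (qRoots z N)) m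
  stirling1-elemSym z N m roots≉0 = begin
    sign (N ∸ℕ m) * coeff (suc m) (qFalling q 1 z (suc N))
      ≡⟨ ≡.cong (λ p → sign (N ∸ℕ m) * coeff (suc m) p)
                (≡.sym (foldr-map mulLin (λ i → qnum q i ^ℤ z) (xPow 1) (range 1 N))) ⟩
    sign (N ∸ℕ m) * coeff (suc m) (linearProduct (qRoots z N))
      ≈⟨ *-congˡ (coeff-linearProduct roots≉0 m) ⟩
    sign (N ∸ℕ m) * (sign (length (qRoots z N) ∸ℕ m) * X)
      ≡⟨ ≡.cong (λ L → sign (N ∸ℕ m) * (sign (L ∸ℕ m) * X)) (length-qRoots z N) ⟩
    sign (N ∸ℕ m) * (sign (N ∸ℕ m) * X)
      ≈⟨ *-assoc _ _ X ⟨
    (sign (N ∸ℕ m) * sign (N ∸ℕ m)) * X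
      ≈⟨ trans (*-congʳ (sign-square (N ∸ℕ m))) (*-identityˡ X) ⟩
    X ∎
    where
    X : Carrier
    X = prodF (qRoots z N) * elemSym (map _⁻¹ (qRoots z N)) m

  stirling2-vanish : ∀ z n k → n < k → stirling2 q 1 z n k ≈ 0#
  stirling2-vanish z zero    (suc k) _ = refl
  stirling2-vanish z (suc n) (suc k) (s≤s n<k) with suc k <? 1
  ... | yes (s≤s ())
  ... | no _ = begin
    stirling2 q 1 z n k + (qnum q (suc k) ^ℤ z) * stirling2 q 1 z n (suc k)
      ≈⟨ +-cong (stirling2-vanish z n k n<k) (*-congˡ (stirling2-vanish z n (suc k) (m≤n⇒m≤1+n n<k))) ⟩
    0# + (qnum q (suc k) ^ℤ z) * 0# ≈⟨ trans (+-identityˡ _) (zeroʳ _) ⟩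
    0#                              ∎

  stirling2-diagonal : ∀ z k → stirling2 q 1 z k k ≈ 1#
  stirling2-diagonal z zero    = refl
  stirling2-diagonal z (suc k) with suc k <? 1
  ... | yes (s≤s ())
  ... | no _ = begin
    stirling2 q 1 z k k + (qnum q (suc k) ^ℤ z) * stirling2 q 1 z k (suc k)
      ≈⟨ +-cong (stirling2-diagonal z k) (*-congˡ (stirling2-vanish z k (suc k) ≤-refl)) ⟩
    1# + (qnum q (suc k) ^ℤ z) * 0# ≈⟨ trans (+-congˡ (zeroʳ _)) (+-identityʳ 1#) ⟩
    1#                              ∎

  stirling2-homSym : ∀ z K m → stirling2 q 1 z (K +ℕ m) K ≈ homSym (map (λ i → qnum q i ^ℤ z) (range 1 K)) m
  stirling2-homSym z zero    zero    = refl
  stirling2-homSym z zero    (suc m) = refl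
  stirling2-homSym z (suc K) zero    =
    trans (reflexive (≡.cong (λ n → stirling2 q 1 z n (suc K)) (ℕ.+-identityʳ (suc K)))) (stirling2-diagonal z (suc K))
  stirling2-homSym z (suc K) (suc m) with suc K <? 1
  ... | yes (s≤s ())
  ... | no _ = begin
    stirling2 q 1 z (K +ℕ suc m) K + v (suc K) * stirling2 q 1 z (K +ℕ suc m) (suc K)
      ≈⟨ +-cong (stirling2-homSym z K (suc m))
                (*-congˡ (trans (reflexive (≡.cong (λ n → stirling2 q 1 z n (suc K)) (ℕ.+-suc K m)))
                                (stirling2-homSym z (suc K) m))) ⟩
    homSym vs (suc m) + v (suc K) * homSym (map v (range 1 (suc K))) m
      ≡⟨ ≡.cong (λ ys → homSym vs (suc m) + v (suc K) * homSym ys m) (map-range-∷ʳ v 1 K (s≤s z≤n)) ⟩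
    homSym vs (suc m) + v (suc K) * homSym (vs ∷ʳ v (suc K)) m
      ≈⟨ homSym-∷ʳ vs (v (suc K)) m ⟨
    homSym (vs ∷ʳ v (suc K)) (suc m)
      ≡⟨ ≡.cong (λ ys → homSym ys (suc m)) (map-range-∷ʳ v 1 K (s≤s z≤n)) ⟨
    homSym (map v (range 1 (suc K))) (suc m) ∎
    where
    v : ℕ → Carrier
    v i = qnum q i ^ℤ z
    vs : List Carrier
    vs = map v (range 1 K)

  qfact-range : ∀ K → prodF (map (qnum q) (range 1 K)) ≈ qfact q K
  qfact-range zero    = refl
  qfact-range (suc K) = begin
    prodF (map (qnum q) (range 1 (suc K)))
      ≡⟨ ≡.cong prodF (map-range-∷ʳ (qnum q) 1 K (s≤s z≤n)) ⟩
    prodF (map (qnum q) (range 1 K) ∷ʳ qnum q (suc K))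
      ≈⟨ prodF-∷ʳ (map (qnum q) (range 1 K)) (qnum q (suc K)) ⟩
    prodF (map (qnum q) (range 1 K)) * qnum q (suc K)
      ≈⟨ trans (*-congʳ (qfact-range K)) (*-comm _ _) ⟩
    qfact q (suc K) ∎

  module _ (q≉1 : q ≉ 1#) where

    1-q≉0 : 1# - q ≉ 0#
    1-q≉0 = x≉y⇒x-y≉0 (q≉1 ∘ sym)

    1-qⁿ≈[1-q][n] : ∀ n → 1# - q ^ n ≈ (1# - q) * qnum q n
    1-qⁿ≈[1-q][n] n = begin
      1# - q ^ n                   ≈⟨ ⁻¹-anti-homo-// (q ^ n) 1# ⟨
      - (q ^ n - 1#)               ≈⟨ -‿cong (x[yx⁻¹]≈y (x≉y⇒x-y≉0 q≉1) (q ^ n - 1#)) ⟨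
      - ((q - 1#) * qnum q n)      ≈⟨ -‿distribˡ-* (q - 1#) (qnum q n) ⟩
      - (q - 1#) * qnum q n        ≈⟨ *-congʳ (⁻¹-anti-homo-// q 1#) ⟩
      (1# - q) * qnum q n          ∎

    qnum-≉0 : ∀ {n} → q ^ n ≉ 1# → qnum q n ≉ 0#
    qnum-≉0 {n} qⁿ≉1 [n]≈0 = x≉y⇒x-y≉0 (qⁿ≉1 ∘ sym) (begin
      1# - q ^ n          ≈⟨ 1-qⁿ≈[1-q][n] n ⟩
      (1# - q) * qnum q n ≈⟨ *-congˡ [n]≈0 ⟩
      (1# - q) * 0#       ≈⟨ zeroʳ _ ⟩
      0#                  ∎)

    zeta-weight : ∀ s {i} → q ^ i ≉ 1# → ((1# - q ^ i) ^ s) ⁻¹ ≈ ((1# - q) ^ s) ⁻¹ * (qnum q i ^ s) ⁻¹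
    zeta-weight s {i} qⁱ≉1 = begin
      ((1# - q ^ i) ^ s) ⁻¹           ≈⟨ ⁻¹-cong (^-≉0 s (x≉y⇒x-y≉0 (qⁱ≉1 ∘ sym)))
                                                (trans (^-congˡ s (1-qⁿ≈[1-q][n] i)) (^-distrib-* _ _ s)) ⟩
      ((1# - q) ^ s * qnum q i ^ s) ⁻¹ ≈⟨ ⁻¹-distrib-* (^-≉0 s 1-q≉0) (^-≉0 s (qnum-≉0 {i} qⁱ≉1)) ⟩
      ((1# - q) ^ s) ⁻¹ * (qnum q i ^ s) ⁻¹ ∎

    module _ {N} (qⁱ≉1-range : All (λ i → q ^ i ≉ 1#) (range 1 N)) where

      qfact-≉0 : qfact q N ≉ 0#
      qfact-≉0 qfact≈0 =
        prodF-≉0 (x≉0⇒1≉0 1-q≉0) (map⁺ (All.map (λ {i} → qnum-≉0 {i}) qⁱ≉1-range)) (trans (qfact-range N) qfact≈0)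

      stirling1-qfact : ∀ s m →
        stirling1 q 1 (+ s) (suc N) (suc m) ≈ qfact q N ^ s * elemSym (map _⁻¹ (qRoots (+ s) N)) m
      stirling1-qfact s m = trans (stirling1-elemSym (+ s) N m roots≉0) (*-congʳ prodF-roots)
        where
        roots≉0 : All (_≉ 0#) (qRoots (+ s) N)
        roots≉0 = map⁺ (All.map (λ {i} → ^-≉0 s ∘ qnum-≉0 {i}) qⁱ≉1-range)
        prodF-roots : prodF (qRoots (+ s) N) ≈ qfact q N ^ s
        prodF-roots = trans (prodF-map-^ (qnum q) s (range 1 N)) (^-congˡ s (qfact-range N))

      zeta-elemSym : ∀ m s →
        Zeta q (suc N) m s ≈ (((1# - q) ^ s) ⁻¹) ^ m * elemSym (map _⁻¹ (qRoots (+ s) N)) m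
      zeta-elemSym m s = begin
        Zeta q (suc N) m s
          ≈⟨ weightSum-incSeqs (λ i → ((1# - q ^ i) ^ s) ⁻¹) 1 N m ⟩
        elemSym (map (λ i → ((1# - q ^ i) ^ s) ⁻¹) (range 1 N)) m
          ≈⟨ elemSym-cong (map-≋ (All.map (λ {i} → zeta-weight s {i}) qⁱ≉1-range)) m ⟩
        elemSym (map ((k *_) ∘ f) (range 1 N)) m
          ≡⟨ ≡.cong (λ xs → elemSym xs m) (map-∘ (range 1 N)) ⟩
        elemSym (map (k *_) (map f (range 1 N))) m
          ≈⟨ elemSym-scale k (map f (range 1 N)) m ⟩
        k ^ m * elemSym (map f (range 1 N)) m
          ≡⟨ ≡.cong (λ xs → k ^ m * elemSym xs m) (map-∘ (range 1 N)) ⟩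
        k ^ m * elemSym (map _⁻¹ (qRoots (+ s) N)) m ∎
        where
        k : Carrier
        k = ((1# - q) ^ s) ⁻¹
        f : ℕ → Carrier
        f i = (qnum q i ^ s) ⁻¹

      zeta-stirling1 : ∀ m s →
        Zeta q (suc N) m s ≈ ((1# - q) ^ (m *ℕ s) * qfact q N ^ s) ⁻¹ * stirling1 q 1 (+ s) (suc N) (suc m)
      zeta-stirling1 m s = begin
        Zeta q (suc N) m s
          ≈⟨ zeta-elemSym m s ⟩
        (((1# - q) ^ s) ⁻¹) ^ m * E
          ≈⟨ *-congʳ (⁻¹-^-* m s 1-q≉0) ⟩
        ((1# - q) ^ (m *ℕ s)) ⁻¹ * E
          ≈⟨ ⁻¹-*-extend (^-≉0 (m *ℕ s) 1-q≉0) (^-≉0 s qfact-≉0) E ⟩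
        ((1# - q) ^ (m *ℕ s) * qfact q N ^ s) ⁻¹ * (qfact q N ^ s * E)
          ≈⟨ *-congˡ (stirling1-qfact s m) ⟨
        ((1# - q) ^ (m *ℕ s) * qfact q N ^ s) ⁻¹ * stirling1 q 1 (+ s) (suc N) (suc m) ∎
        where
        E : Carrier
        E = elemSym (map _⁻¹ (qRoots (+ s) N)) m

      zetaStar-homSym : ∀ m s →
        ZetaStar q (suc N) m (suc s) ≈ (((1# - q) ^ suc s) ⁻¹) ^ m * homSym (qRoots -[1+ s ] N) m
      zetaStar-homSym m s = begin
        ZetaStar q (suc N) m (suc s)
          ≈⟨ weightSum-wkSeqs (λ i → ((1# - q ^ i) ^ suc s) ⁻¹) 1 N m ⟩
        homSym (map (λ i → ((1# - q ^ i) ^ suc s) ⁻¹) (range 1 N)) m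
          ≈⟨ homSym-cong (map-≋ (All.map (λ {i} → weight≈ {i}) qⁱ≉1-range)) m ⟩
        homSym (map ((k *_) ∘ f) (range 1 N)) m
          ≡⟨ ≡.cong (λ xs → homSym xs m) (map-∘ (range 1 N)) ⟩
        homSym (map (k *_) (qRoots -[1+ s ] N)) m
          ≈⟨ homSym-scale k (qRoots -[1+ s ] N) m ⟩
        k ^ m * homSym (qRoots -[1+ s ] N) m ∎
        where
        k : Carrier
        k = ((1# - q) ^ suc s) ⁻¹
        f : ℕ → Carrier
        f i = qnum q i ^ℤ -[1+ s ]
        weight≈ : ∀ {i} → q ^ i ≉ 1# → ((1# - q ^ i) ^ suc s) ⁻¹ ≈ k * f i
        weight≈ {i} qⁱ≉1 = trans (zeta-weight (suc s) {i} qⁱ≉1) (*-congˡ (⁻¹-^ (suc s) (qnum-≉0 {i} qⁱ≉1)))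

      zetaStar-stirling2 : ∀ m s →
        ZetaStar q (suc N) m (suc s) ≈ ((1# - q) ^ (m *ℕ suc s)) ⁻¹ * stirling2 q 1 -[1+ s ] (N +ℕ m) N
      zetaStar-stirling2 m s =
        trans (zetaStar-homSym m s) (*-cong (⁻¹-^-* m (suc s) 1-q≉0) (sym (stirling2-homSym -[1+ s ] N m)))

proposition1 : ∀ {c ℓ} (F : Field c ℓ) →
    let open Field F
        open FieldDefs F
    in (q : Carrier) → ¬ (q ≈ 1#) → (n m s : ℕ) →
       (∀ i → 1 ≤ i → i < n → ¬ ((q ^ i) ≈ 1#)) →
       1 ≤ n → 1 ≤ m → 1 ≤ s →
       (Zeta q n m s ≈ (((1# - q) ^ (m *ℕ s)) * (qfact q (n ∸ℕ 1) ^ s)) ⁻¹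
                        * stirling1 q 1 (+ s) n (m +ℕ 1))
       × (ZetaStar q n m s ≈ ((1# - q) ^ (m *ℕ s)) ⁻¹
                        * stirling2 q 1 (-ℤ (+ s)) (n +ℕ m ∸ℕ 1) (n ∸ℕ 1))
-- The identities hold for m = 0 as well.
proposition1 F q q≉1 (suc N) m (suc s) qⁱ≉1 _ _ _ rewrite ℕ.+-comm m 1 =
  zeta-stirling1 q≉1 qⁱ≉1-range m (suc s) , zetaStar-stirling2 q≉1 qⁱ≉1-range m s
  where
  open Field F
  open FieldDefs F
  open QCalculus F q

  qⁱ≉1-range : All (λ i → q ^ i ≉ 1#) (range 1 N)
  qⁱ≉1-range = All-range 1 N λ i 1≤i i≤N → qⁱ≉1 i 1≤i (s≤s i≤N)
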